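{- Let $B$ be an arbitrary language over a finite ordered alphabet $\Gamma$, and let $A \subseteq \Delta^*$ be a language describable by a sentence of the form $Q_B x\,[\phi_1(x),\dots,\phi_{|\Gamma|-1}(x)]$, where the $\phi_i$ are first-order formulas (with linear order, without BIT) and $Q_B$ is the unary Lindström quantifier given by $B$ (binding exactly the one variable $x$). Then there exist length-preserving homomorphisms $g,h$ and a regular language $D$ such that $A = h(D \cap g^{ -1}(B))$.
   Context: Words $w=w_1\cdots w_n$ over a finite ordered alphabet $\Delta$ are viewed as finite structures with universe $\{1,\dots,n\}$, unary predicates $P_a$ for $a\in\Delta$ ($P_a(j)$ holds iff $w_j=a$), the linear order $<$, equality, and constants min, max; first-order (FO) formulas are built over this signature. Lindström quantifier: for a language $L$ over an ordered alphabet $(b_1,\dots,b_t)$, a $k$-tuple of variables $\bar x$, and formulas $\phi_1(\bar x),\dots,\phi_{t-1}(\bar x)$, the formula $Q_L\bar x[\phi_1,\dots,\phi_{t-1}]$ holds on a word $w$ of length $n$ iff the word of length $n^k$ whose $i$th letter ($X_1,\dots,X_{n^k}$ being the $k$-tuples over $\{1,\dots,n\}$ in lexicographic order) is $b_j$ for the least $j\le t-1$ with $w\models\phi_j(X_i)$, and $b_t$ if there is no such $j$, belongs to $L$. The quantifier is unary if $k=1$. A homomorphism $\Sigma^*\to\Delta^*$ is length-preserving if it maps each letter to a letter. -}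

module Defs where

open import Data.Nat using (ℕ; zero; suc)
open import Data.Fin using (Fin; zero; suc; fromℕ; _<?_; _≟_)
open import Data.Bool using (Bool; true; false; not; _∧_; _∨_; if_then_else_)
open import Data.List using (List; []; _∷_; length; lookup; map; foldl)
import Data.List as List
open import Relation.Nullary.Decidable using (⌊_⌋)

-- Languages over an alphabet A (finite alphabets are Fin m, ordered by Fin's order)
Language : Set → Set₁
Language A = List A → Set

-- First-order formulas over the word signature for alphabet Fin m,
-- with k free variables (de Bruijn indices).
data Term (k : ℕ) : Set where
  var : Fin k → Term k
  min : Term k
  max : Term k

data Formula (m : ℕ) : ℕ → Set where
  P    : ∀ {k} → Fin m → Term k → Formula m k
  _≺_  : ∀ {k} → Term k → Term k → Formula m k
  _≐_  : ∀ {k} → Term k → Term k → Formula m k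
  ⊤f   : ∀ {k} → Formula m k
  ¬f   : ∀ {k} → Formula m k → Formula m k
  _∧f_ : ∀ {k} → Formula m k → Formula m k → Formula m k
  _∨f_ : ∀ {k} → Formula m k → Formula m k → Formula m k
  ∃f   : ∀ {k} → Formula m (suc k) → Formula m k
  ∀f   : ∀ {k} → Formula m (suc k) → Formula m k

anyFin : ∀ {n} → (Fin n → Bool) → Bool
anyFin {zero}  f = false
anyFin {suc n} f = f zero ∨ anyFin (λ i → f (suc i))

allFin : ∀ {n} → (Fin n → Bool) → Bool
allFin {zero}  f = true
allFin {suc n} f = f zero ∧ allFin (λ i → f (suc i))

extend : ∀ {k n} → Fin n → (Fin k → Fin n) → Fin (suc k) → Fin n
extend i ρ zero    = i
extend i ρ (suc j) = ρ j

evalT : ∀ {k n} → (Fin k → Fin (suc n)) → Term k → Fin (suc n)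
evalT ρ (var x) = ρ x
evalT ρ min     = zero
evalT {n = n} ρ max = fromℕ n

-- Satisfaction of a formula in a nonempty word w (as the function position ↦ letter)
-- under an assignment ρ of the free variables.
eval : ∀ {m k n} → Formula m k → (Fin (suc n) → Fin m) → (Fin k → Fin (suc n)) → Bool
eval (P a t)   w ρ = ⌊ w (evalT ρ t) ≟ a ⌋
eval (s ≺ t)   w ρ = ⌊ evalT ρ s <? evalT ρ t ⌋
eval (s ≐ t)   w ρ = ⌊ evalT ρ s ≟ evalT ρ t ⌋
eval ⊤f        w ρ = true
eval (¬f φ)    w ρ = not (eval φ w ρ)
eval (φ ∧f ψ)  w ρ = eval φ w ρ ∧ eval ψ w ρ
eval (φ ∨f ψ)  w ρ = eval φ w ρ ∨ eval ψ w ρ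
eval (∃f φ)    w ρ = anyFin (λ i → eval φ w (extend i ρ))
eval (∀f φ)    w ρ = allFin (λ i → eval φ w (extend i ρ))

-- Least j ≤ s with f j true (letter b_{j}); the last letter b_{s+1} if none.
firstTrue : ∀ {s} → (Fin s → Bool) → Fin (suc s)
firstTrue {zero}  f = zero
firstTrue {suc s} f = if f zero then zero else suc (firstTrue (λ j → f (suc j)))

-- The word of length n built by the unary Lindström quantifier Q_B x [φ_1..φ_s]
-- (alphabet Γ = Fin (suc s), b_j = j-th element) on the input word w.
qword : ∀ {m s} → (Fin s → Formula m 1) → List (Fin m) → List (Fin (suc s))
qword φ []       = []
qword φ (a ∷ as) =
  List.tabulate {n = suc (length as)}
    (λ i → firstTrue (λ j → eval (φ j) (lookup (a ∷ as)) (λ _ → i)))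

QSat : ∀ {m s} → Language (Fin (suc s)) → (Fin s → Formula m 1) → Language (Fin m)
QSat B φ w = B (qword φ w)

record DFA (p : ℕ) : Set where
  field
    states : ℕ
    start  : Fin states
    δ      : Fin states → Fin p → Fin states
    accept : Fin states → Bool

accepts : ∀ {p} → DFA p → List (Fin p) → Bool
accepts M u = DFA.accept M (foldl (DFA.δ M) (DFA.start M) u)

Regular : ∀ {p} → Language (Fin p) → Set
Regular {p} D = Σ' (DFA p) (λ M → ∀ u → (D u → accepts M u ≡ true) × (accepts M u ≡ true → D u))
  where
  open import Data.Product using (_×_) renaming (Σ to Σ')
  open import Relation.Binary.PropositionalEquality using (_≡_)

hom : ∀ {p q} → (Fin p → Fin q) → List (Fin p) → List (Fin q)
hom f = map f

-- Write a letter of Fin (m * (s + 1)) as a pair of an input letter (its h-image) and a letter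
-- of Γ (its g-image), and let D be the set of words whose Γ-track is exactly the word that the
-- Lindström quantifier builds from their input track.  Then h maps D ∩ g⁻¹(B) onto A, since every
-- input word has exactly one preimage in D.  D is regular because it is defined by the
-- first-order sentence  ∀x. label(x) = least j with φ_j(x)  over the pair alphabet, and
-- first-order logic over words only defines regular languages (Büchi-McNaughton): a formula with
-- k free variables is compiled to an automaton reading letters with k extra marking bits, the
-- connectives become product and complement automata, and ∃ becomes a subset construction that
-- guesses the position of the quantified variable.

module Submission where

open import Defs
open import Data.Nat using (ℕ; suc)
open import Data.Fin using (Fin)
open import Data.List using (List)
open import Data.Product using (Σ; ∃; _×_)
open import Function.Bundles using (_⇔_)
open import Relation.Binary.PropositionalEquality using (_≡_)

open import Algebra using (CommutativeMonoid)
open import Data.Bool using (Bool; true; false; not; _∧_; _∨_; if_then_else_)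
open import Data.Bool.Properties
  using ( ∨-assoc; ∧-assoc; ∨-identityʳ; ∧-zeroʳ; ∧-conicalˡ; ∧-conicalʳ; ∧-distribˡ-∨; ∧-distribʳ-∨
        ; ∨-commutativeMonoid )
open import Data.Fin
  using (zero; suc; toℕ; fromℕ; cast; _≟_; _<?_; combine; quotient; remainder; funToFin; finToFun)
open import Data.Fin.Patterns using (0F; 1F; 2F; 3F)
open import Data.Fin.Properties using (remQuot-combine; cast-is-id; finToFun-funToFin; 2↔Bool)
open import Data.List using ([]; _∷_; foldl; map; tabulate; lookup)
open import Data.List.Properties
  using (map-tabulate; tabulate-cong; tabulate-lookup; length-map; ∷-injectiveˡ; ∷-injectiveʳ)
open import Data.Nat using (zero; _<ᵇ_; _*_; _^_)
open import Data.Product using (_,_; proj₁; proj₂)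
open import Data.Vec.Functional as Vector using ()
open import Function using (_∘_; id)
open import Function.Bundles using (Inverse; mk⇔; Equivalence)
open import Relation.Binary.PropositionalEquality
  using (refl; sym; trans; cong; cong₂; subst; _≗_; module ≡-Reasoning)
open import Relation.Nullary.Decidable using (⌊_⌋; does; isYes≗does)
open import Algebra.Properties.CommutativeSemigroup
  (CommutativeMonoid.commutativeSemigroup ∨-commutativeMonoid) using (interchange)

-- Booleans and finite disjunctions over Fin

-- Defined with does rather than ⌊_⌋ so that suc i == suc j reduces to i == j.
infix 4 _==_
_==_ : ∀ {n} → Fin n → Fin n → Bool
i == j = does (i ≟ j)

==-refl : ∀ {n} (i : Fin n) → (i == i) ≡ true
==-refl zero            = refl
==-refl {suc n} (suc i) = ==-refl {n} i

==⇒≡ : ∀ {n} {i j : Fin n} → (i == j) ≡ true → i ≡ j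
==⇒≡ {i = zero} {zero}      _ = refl
==⇒≡ {suc n} {suc i} {suc j} e = cong suc (==⇒≡ {n} e)

<ᵇ-suc : ∀ a b → (suc a <ᵇ suc b) ≡ (a <ᵇ b)
<ᵇ-suc zero    zero    = refl
<ᵇ-suc zero    (suc b) = refl
<ᵇ-suc (suc a) zero    = refl
<ᵇ-suc (suc a) (suc b) = refl

<?-suc : ∀ {n} (i j : Fin n) → does (suc i <? suc j) ≡ does (i <? j)
<?-suc i j = <ᵇ-suc (toℕ i) (toℕ j)

anyFin-cong : ∀ {n} {f g : Fin n → Bool} → f ≗ g → anyFin f ≡ anyFin g
anyFin-cong {zero}  e = refl
anyFin-cong {suc n} e = cong₂ _∨_ (e zero) (anyFin-cong (e ∘ suc))

allFin-cong : ∀ {n} {f g : Fin n → Bool} → f ≗ g → allFin f ≡ allFin g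
allFin-cong {zero}  e = refl
allFin-cong {suc n} e = cong₂ _∧_ (e zero) (allFin-cong (e ∘ suc))

anyFin-false : ∀ {n} → anyFin {n} (λ _ → false) ≡ false
anyFin-false {zero}  = refl
anyFin-false {suc n} = anyFin-false {n}

anyFin-∧-false : ∀ {n} (f : Fin n → Bool) → anyFin (λ i → f i ∧ false) ≡ false
anyFin-∧-false {n} f = trans (anyFin-cong (∧-zeroʳ ∘ f)) (anyFin-false {n})

anyFin-∨ : ∀ {n} (f g : Fin n → Bool) → anyFin (λ i → f i ∨ g i) ≡ anyFin f ∨ anyFin g
anyFin-∨ {zero}  f g = refl
anyFin-∨ {suc n} f g =
  trans (cong ((f zero ∨ g zero) ∨_) (anyFin-∨ (f ∘ suc) (g ∘ suc)))
        (interchange (f zero) (g zero) _ _)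

anyFin-∧ˡ : ∀ {n} b (f : Fin n → Bool) → anyFin (λ i → b ∧ f i) ≡ b ∧ anyFin f
anyFin-∧ˡ {zero}  b f = sym (∧-zeroʳ b)
anyFin-∧ˡ {suc n} b f =
  trans (cong ((b ∧ f zero) ∨_) (anyFin-∧ˡ b (f ∘ suc))) (sym (∧-distribˡ-∨ b (f zero) _))

anyFin-∧ʳ : ∀ {n} b (f : Fin n → Bool) → anyFin (λ i → f i ∧ b) ≡ anyFin f ∧ b
anyFin-∧ʳ {zero}  b f = refl
anyFin-∧ʳ {suc n} b f =
  trans (cong ((f zero ∧ b) ∨_) (anyFin-∧ʳ b (f ∘ suc))) (sym (∧-distribʳ-∨ b (f zero) _))

anyFin-comm : ∀ {n k} (f : Fin n → Fin k → Bool) →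
  anyFin (λ i → anyFin (λ j → f i j)) ≡ anyFin (λ j → anyFin (λ i → f i j))
anyFin-comm {zero}  {k} f = sym (anyFin-false {k})
anyFin-comm {suc n} f =
  trans (cong (anyFin (f zero) ∨_) (anyFin-comm (f ∘ suc)))
        (sym (anyFin-∨ (f zero) (λ j → anyFin (λ i → f (suc i) j))))

anyFin-select : ∀ {n} (i : Fin n) (Q : Fin n → Bool) → anyFin (λ j → (i == j) ∧ Q j) ≡ Q i
anyFin-select {suc n} zero    Q = trans (cong (Q zero ∨_) (anyFin-false {n})) (∨-identityʳ (Q zero))
anyFin-select {suc n} (suc i) Q = anyFin-select i (Q ∘ suc)

allFin≡not-anyFin-not : ∀ {n} (f : Fin n → Bool) → allFin f ≡ not (anyFin (not ∘ f))
allFin≡not-anyFin-not {zero}  f = refl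
allFin≡not-anyFin-not {suc n} f with f zero
... | true  = allFin≡not-anyFin-not (f ∘ suc)
... | false = refl

allFin-true⁻ : ∀ {n} (f : Fin n → Bool) → allFin f ≡ true → ∀ i → f i ≡ true
allFin-true⁻ f e zero    = ∧-conicalˡ _ _ e
allFin-true⁻ f e (suc i) = allFin-true⁻ (f ∘ suc) (∧-conicalʳ _ _ e) i

allFin-true⁺ : ∀ {n} (f : Fin n → Bool) → (∀ i → f i ≡ true) → allFin f ≡ true
allFin-true⁺ {zero}  f h = refl
allFin-true⁺ {suc n} f h = cong₂ _∧_ (h zero) (allFin-true⁺ (f ∘ suc) (h ∘ suc))

image : ∀ {N M} → (Fin N → Bool) → (Fin N → Fin M) → Fin M → Bool
image T g t = anyFin (λ s → T s ∧ (g s == t))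

anyFin-image : ∀ {N M} (T : Fin N → Bool) (g : Fin N → Fin M) (Q : Fin M → Bool) →
  anyFin (λ t → image T g t ∧ Q t) ≡ anyFin (λ s → T s ∧ Q (g s))
anyFin-image T g Q = begin
  anyFin (λ t → anyFin (λ s → T s ∧ (g s == t)) ∧ Q t)
    ≡⟨ anyFin-cong (λ t → sym (anyFin-∧ʳ (Q t) (λ s → T s ∧ (g s == t)))) ⟩
  anyFin (λ t → anyFin (λ s → (T s ∧ (g s == t)) ∧ Q t))
    ≡⟨ anyFin-comm (λ t s → (T s ∧ (g s == t)) ∧ Q t) ⟩
  anyFin (λ s → anyFin (λ t → (T s ∧ (g s == t)) ∧ Q t))
    ≡⟨ anyFin-cong (λ s → trans (anyFin-cong (λ t → ∧-assoc (T s) (g s == t) (Q t)))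
                                 (anyFin-∧ˡ (T s) (λ t → (g s == t) ∧ Q t))) ⟩
  anyFin (λ s → T s ∧ anyFin (λ t → (g s == t) ∧ Q t))
    ≡⟨ anyFin-cong (λ s → cong (T s ∧_) (anyFin-select (g s) Q)) ⟩
  anyFin (λ s → T s ∧ Q (g s)) ∎
  where open ≡-Reasoning

quotient-combine : ∀ {a b} (i : Fin a) (j : Fin b) → quotient b (combine i j) ≡ i
quotient-combine i j = cong proj₁ (remQuot-combine i j)

remainder-combine : ∀ {a b} (i : Fin a) (j : Fin b) → remainder {a} b (combine i j) ≡ j
remainder-combine i j = cong proj₂ (remQuot-combine i j)

bit : Bool → Fin 2
bit = Inverse.from 2↔Bool

isSet : Fin 2 → Bool
isSet = Inverse.to 2↔Bool

isSet-bit : ∀ b → isSet (bit b) ≡ b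
isSet-bit = Inverse.strictlyInverseˡ 2↔Bool

encodeSubset : ∀ {N} → (Fin N → Bool) → Fin (2 ^ N)
encodeSubset T = funToFin (bit ∘ T)

decodeSubset : ∀ {N} → Fin (2 ^ N) → Fin N → Bool
decodeSubset x = isSet ∘ finToFun x

decode-encodeSubset : ∀ {N} (T : Fin N → Bool) → decodeSubset (encodeSubset T) ≗ T
decode-encodeSubset T i = trans (cong isSet (finToFun-funToFin (bit ∘ T) i)) (isSet-bit (T i))

-- Automata

record Automaton (L : Set) : Set where
  field
    states : ℕ
    start  : Fin states
    δ      : Fin states → L → Fin states
    accept : Fin states → Bool

open Automaton

run : ∀ {L} (M : Automaton L) → Fin (states M) → List L → Fin (states M)
run M = foldl (δ M)

accepted : ∀ {L} → Automaton L → List L → Bool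
accepted M u = accept M (run M (start M) u)

run-sink : ∀ {L} (M : Automaton L) q → (∀ a → δ M q a ≡ q) → ∀ u → run M q u ≡ q
run-sink M q sink []      = refl
run-sink M q sink (a ∷ u) = trans (cong (λ q′ → run M q′ u) (sink a)) (run-sink M q sink u)

constant : ∀ {L} → Bool → Automaton L
constant b = record { states = 1 ; start = zero ; δ = λ _ _ → zero ; accept = λ _ → b }

complement : ∀ {L} → Automaton L → Automaton L
complement M = record M { accept = not ∘ accept M }

product : ∀ {L} → (Bool → Bool → Bool) → Automaton L → Automaton L → Automaton L
product op M₁ M₂ = record
  { states = states M₁ * states M₂
  ; start  = combine (start M₁) (start M₂)
  ; δ      = λ q a → combine (δ M₁ (left q) a) (δ M₂ (right q) a)
  ; accept = λ q → op (accept M₁ (left q)) (accept M₂ (right q))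
  }
  where
  left  : Fin (states M₁ * states M₂) → Fin (states M₁)
  left  = quotient (states M₂)
  right : Fin (states M₁ * states M₂) → Fin (states M₂)
  right = remainder {states M₁} (states M₂)

run-product : ∀ {L} op (M₁ M₂ : Automaton L) q₁ q₂ u →
  run (product op M₁ M₂) (combine q₁ q₂) u ≡ combine (run M₁ q₁ u) (run M₂ q₂ u)
run-product op M₁ M₂ q₁ q₂ []      = refl
run-product op M₁ M₂ q₁ q₂ (a ∷ u) = trans
  (cong (λ q → run (product op M₁ M₂) q u)
        (cong₂ (λ q₁′ q₂′ → combine (δ M₁ q₁′ a) (δ M₂ q₂′ a))
               (quotient-combine q₁ q₂) (remainder-combine q₁ q₂)))
  (run-product op M₁ M₂ (δ M₁ q₁ a) (δ M₂ q₂ a) u)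

accepted-product : ∀ {L} op (M₁ M₂ : Automaton L) u →
  accepted (product op M₁ M₂) u ≡ op (accepted M₁ u) (accepted M₂ u)
accepted-product op M₁ M₂ u =
  trans (cong (accept (product op M₁ M₂)) (run-product op M₁ M₂ (start M₁) (start M₂) u))
        (cong₂ (λ q₁ q₂ → op (accept M₁ q₁) (accept M₂ q₂))
               (quotient-combine q₁ q₂) (remainder-combine q₁ q₂))
  where
  q₁ : Fin (states M₁)
  q₁ = run M₁ (start M₁) u
  q₂ : Fin (states M₂)
  q₂ = run M₂ (start M₂) u

relabel : ∀ {L L′} → (L′ → L) → Automaton L → Automaton L′
relabel f M = record { states = states M ; start = start M ; δ = λ q → δ M q ∘ f ; accept = accept M }

run-relabel : ∀ {L L′} (f : L′ → L) (M : Automaton L) q u → run (relabel f M) q u ≡ run M q (map f u)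
run-relabel f M q []      = refl
run-relabel f M q (a ∷ u) = run-relabel f M (δ M q (f a)) u

accepted-relabel : ∀ {L L′} (f : L′ → L) (M : Automaton L) u →
  accepted (relabel f M) u ≡ accepted M (map f u)
accepted-relabel f M u = cong (accept M) (run-relabel f M (start M) u)

-- Recognisers of properties of marked words

-- A word w under an assignment ρ of k position variables is fed to an automaton as the word of
-- letters (w i , mk i), bit x of mk i telling whether ρ x = i.  Tracks are only required to mark ρ
-- pointwise, as the constructions below build them only up to pointwise equality.
Marked : Set → ℕ → Set
Marked A k = A × (Fin k → Bool)

annotate : ∀ {A k n} → (Fin (suc n) → A) → (Fin (suc n) → Fin k → Bool) → List (Marked A k)
annotate w mk = tabulate (λ i → w i , mk i)

_marks_ : ∀ {k n} → (Fin (suc n) → Fin k → Bool) → (Fin k → Fin (suc n)) → Set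
mk marks ρ = ∀ i x → mk i x ≡ (i == ρ x)

Property : Set → ℕ → Set
Property A k = ∀ n → (Fin (suc n) → A) → (Fin k → Fin (suc n)) → Bool

Decides : ∀ {A k} → Automaton (Marked A k) → Property A k → Set
Decides {A} M S = ∀ {n} (w : Fin (suc n) → A) mk ρ → mk marks ρ → accepted M (annotate w mk) ≡ S n w ρ

record Recogniser (A : Set) (k : ℕ) (S : Property A k) : Set where
  field
    automaton : Automaton (Marked A k)
    decides   : Decides automaton S

open Recogniser

castᴿ : ∀ {A k} {S S′ : Property A k} → (∀ n w ρ → S n w ρ ≡ S′ n w ρ) →
  Recogniser A k S → Recogniser A k S′
castᴿ e R = record
  { automaton = automaton R
  ; decides   = λ w mk ρ h → trans (decides R w mk ρ h) (e _ w ρ)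
  }

constantᴿ : ∀ {A k} b → Recogniser A k (λ _ _ _ → b)
constantᴿ b = record { automaton = constant b ; decides = λ _ _ _ _ → refl }

complementᴿ : ∀ {A k} {S : Property A k} → Recogniser A k S → Recogniser A k (λ n w ρ → not (S n w ρ))
complementᴿ R = record
  { automaton = complement (automaton R)
  ; decides   = λ w mk ρ h → cong not (decides R w mk ρ h)
  }

productᴿ : ∀ {A k} {S₁ S₂ : Property A k} op → Recogniser A k S₁ → Recogniser A k S₂ →
  Recogniser A k (λ n w ρ → op (S₁ n w ρ) (S₂ n w ρ))
productᴿ op R₁ R₂ = record
  { automaton = product op (automaton R₁) (automaton R₂)
  ; decides   = λ w mk ρ h → trans (accepted-product op (automaton R₁) (automaton R₂) (annotate w mk))
                                   (cong₂ op (decides R₁ w mk ρ h) (decides R₂ w mk ρ h))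
  }

relabelᴿ : ∀ {A A′ k k′} {S : Property A k} (π : A′ → A) (r : Fin k → Fin k′) →
  Recogniser A k S → Recogniser A′ k′ (λ n w ρ → S n (π ∘ w) (ρ ∘ r))
relabelᴿ {A} {A′} {k} {k′} {S} π r R = record
  { automaton = relabel retrack (automaton R)
  ; decides   = λ w mk ρ h → begin
      accepted (relabel retrack (automaton R)) (annotate w mk)
        ≡⟨ accepted-relabel retrack (automaton R) (annotate w mk) ⟩
      accepted (automaton R) (map retrack (annotate w mk))
        ≡⟨ cong (accepted (automaton R)) (map-tabulate (λ i → w i , mk i) retrack) ⟩
      accepted (automaton R) (annotate (π ∘ w) (λ i → mk i ∘ r))
        ≡⟨ decides R (π ∘ w) (λ i → mk i ∘ r) (ρ ∘ r) (λ i → h i ∘ r) ⟩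
      S _ (π ∘ w) (ρ ∘ r) ∎
  }
  where
  open ≡-Reasoning
  retrack : Marked A′ k′ → Marked A k
  retrack (a , bs) = π a , bs ∘ r

-- Quantifiers

module Projection {A : Set} {k : ℕ} (M : Automaton (Marked A (suc k))) where

  private
    N : ℕ
    N = states M

  code : (Fin N → Bool) → (Fin N → Bool) → Fin (2 ^ N * 2 ^ N)
  code T₀ T₁ = combine (encodeSubset T₀) (encodeSubset T₁)

  unmarked marked : Fin (2 ^ N * 2 ^ N) → Fin N → Bool
  unmarked x = decodeSubset (quotient (2 ^ N) x)
  marked   x = decodeSubset (remainder {2 ^ N} (2 ^ N) x)

  unmarked-code : ∀ T₀ T₁ → unmarked (code T₀ T₁) ≗ T₀
  unmarked-code T₀ T₁ t =
    trans (cong (λ y → decodeSubset y t) (quotient-combine (encodeSubset T₀) (encodeSubset T₁)))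
          (decode-encodeSubset T₀ t)

  marked-code : ∀ T₀ T₁ → marked (code T₀ T₁) ≗ T₁
  marked-code T₀ T₁ t =
    trans (cong (λ y → decodeSubset y t) (remainder-combine (encodeSubset T₀) (encodeSubset T₁)))
          (decode-encodeSubset T₁ t)

  after : Bool → Marked A k → Fin N → Fin N
  after b (a , bs) q = δ M q (a , b Vector.∷ bs)

  -- A state is a pair of sets of states of M: those reachable on the input read so far with the
  -- new track unset everywhere, and those reachable with it set at exactly one position.
  project : Automaton (Marked A k)
  project = record
    { states = 2 ^ N * 2 ^ N
    ; start  = code (start M ==_) (λ _ → false)
    ; δ      = λ x ℓ → code (image (unmarked x) (after false ℓ))
                            (λ t → image (marked x) (after false ℓ) t ∨ image (unmarked x) (after true ℓ) t)
    ; accept = λ x → anyFin (λ t → marked x t ∧ accept M t)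
    }

  addTrack : ∀ {r} → (Fin r → Marked A k) → (Fin r → Bool) → List (Marked A (suc k))
  addTrack F c = tabulate (λ i → proj₁ (F i) , c i Vector.∷ proj₂ (F i))

  project-step : ∀ x ℓ (X Y : Fin N → Bool) →
    anyFin (λ t → marked (δ project x ℓ) t ∧ Y t) ∨ anyFin (λ t → unmarked (δ project x ℓ) t ∧ X t) ≡
    anyFin (λ s → marked x s ∧ Y (after false ℓ s))
      ∨ anyFin (λ s → unmarked x s ∧ (Y (after true ℓ s) ∨ X (after false ℓ s)))
  project-step x ℓ X Y = begin
    anyFin (λ t → marked x′ t ∧ Y t) ∨ anyFin (λ t → unmarked x′ t ∧ X t)
      ≡⟨ cong₂ _∨_ (anyFin-cong (λ t → cong (_∧ Y t) (marked-code T₀′ T₁′ t)))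
                   (anyFin-cong (λ t → cong (_∧ X t) (unmarked-code T₀′ T₁′ t))) ⟩
    anyFin (λ t → (image T₁ g₀ t ∨ image T₀ g₁ t) ∧ Y t) ∨ anyFin (λ t → image T₀ g₀ t ∧ X t)
      ≡⟨ cong (_∨ anyFin (λ t → image T₀ g₀ t ∧ X t))
              (trans (anyFin-cong (λ t → ∧-distribʳ-∨ (Y t) (image T₁ g₀ t) (image T₀ g₁ t)))
                     (anyFin-∨ (λ t → image T₁ g₀ t ∧ Y t) (λ t → image T₀ g₁ t ∧ Y t))) ⟩
    (anyFin (λ t → image T₁ g₀ t ∧ Y t) ∨ anyFin (λ t → image T₀ g₁ t ∧ Y t))
      ∨ anyFin (λ t → image T₀ g₀ t ∧ X t)
      ≡⟨ cong₂ _∨_ (cong₂ _∨_ (anyFin-image T₁ g₀ Y) (anyFin-image T₀ g₁ Y)) (anyFin-image T₀ g₀ X) ⟩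
    (anyFin (λ s → T₁ s ∧ Y (g₀ s)) ∨ anyFin (λ s → T₀ s ∧ Y (g₁ s))) ∨ anyFin (λ s → T₀ s ∧ X (g₀ s))
      ≡⟨ ∨-assoc (anyFin (λ s → T₁ s ∧ Y (g₀ s))) _ _ ⟩
    anyFin (λ s → T₁ s ∧ Y (g₀ s)) ∨ (anyFin (λ s → T₀ s ∧ Y (g₁ s)) ∨ anyFin (λ s → T₀ s ∧ X (g₀ s)))
      ≡⟨ cong (anyFin (λ s → T₁ s ∧ Y (g₀ s)) ∨_)
              (trans (sym (anyFin-∨ (λ s → T₀ s ∧ Y (g₁ s)) (λ s → T₀ s ∧ X (g₀ s))))
                     (anyFin-cong (λ s → sym (∧-distribˡ-∨ (T₀ s) (Y (g₁ s)) (X (g₀ s)))))) ⟩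
    anyFin (λ s → T₁ s ∧ Y (g₀ s)) ∨ anyFin (λ s → T₀ s ∧ (Y (g₁ s) ∨ X (g₀ s))) ∎
    where
    open ≡-Reasoning
    g₀ g₁ : Fin N → Fin N
    g₀ = after false ℓ
    g₁ = after true ℓ
    T₀ T₁ T₀′ T₁′ : Fin N → Bool
    T₀  = unmarked x
    T₁  = marked x
    T₀′ = image T₀ g₀
    T₁′ = λ t → image T₁ g₀ t ∨ image T₀ g₁ t
    x′ : Fin (2 ^ N * 2 ^ N)
    x′ = δ project x ℓ

  marked-run : ∀ {r} (F : Fin r → Marked A k) x (Q : Fin N → Bool) →
    anyFin (λ t → marked (run project x (tabulate F)) t ∧ Q t) ≡
    anyFin (λ s → marked x s ∧ Q (run M s (addTrack F (λ _ → false))))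
      ∨ anyFin (λ s → unmarked x s ∧ anyFin (λ j → Q (run M s (addTrack F (_== j)))))
  marked-run {zero} F x Q =
    sym (trans (cong (anyFin (λ s → marked x s ∧ Q s) ∨_) (anyFin-∧-false (unmarked x))) (∨-identityʳ _))
  marked-run {suc r} F x Q =
    trans (marked-run (F ∘ suc) (δ project x (F zero)) Q) (project-step x (F zero) X Y)
    where
    X Y : Fin N → Bool
    X t = anyFin (λ j → Q (run M t (addTrack (F ∘ suc) (_== j))))
    Y t = Q (run M t (addTrack (F ∘ suc) (λ _ → false)))

  accepted-project : ∀ {r} (F : Fin r → Marked A k) →
    accepted project (tabulate F) ≡ anyFin (λ j → accepted M (addTrack F (_== j)))
  accepted-project F = begin
    accepted project (tabulate F)
      ≡⟨ marked-run F (start project) (accept M) ⟩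
    anyFin (λ s → marked x₀ s ∧ Y s) ∨ anyFin (λ s → unmarked x₀ s ∧ X s)
      ≡⟨ cong₂ _∨_ (trans (anyFin-cong (λ s → cong (_∧ Y s) (marked-code T₀ T₁ s))) (anyFin-false {N}))
                   (anyFin-cong (λ s → cong (_∧ X s) (unmarked-code T₀ T₁ s))) ⟩
    anyFin (λ s → (start M == s) ∧ X s)
      ≡⟨ anyFin-select (start M) X ⟩
    X (start M) ∎
    where
    open ≡-Reasoning
    T₀ T₁ : Fin N → Bool
    T₀ = start M ==_
    T₁ = λ _ → false
    x₀ : Fin (2 ^ N * 2 ^ N)
    x₀ = start project
    X Y : Fin N → Bool
    X s = anyFin (λ j → accept M (run M s (addTrack F (_== j))))
    Y s = accept M (run M s (addTrack F (λ _ → false)))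

open Projection using (project; accepted-project)

∃ᴿ : ∀ {A k} {S : Property A (suc k)} → Recogniser A (suc k) S →
  Recogniser A k (λ n w ρ → anyFin (λ j → S n w (extend j ρ)))
∃ᴿ {A} {k} R = record
  { automaton = project (automaton R)
  ; decides   = λ w mk ρ h →
      trans (accepted-project (automaton R) (λ i → w i , mk i))
            (anyFin-cong (λ j → decides R w (λ i → (i == j) Vector.∷ mk i) (extend j ρ) (marks-extend h j)))
  }
  where
  marks-extend : ∀ {n} {mk : Fin (suc n) → Fin k → Bool} {ρ} → mk marks ρ → ∀ j →
    (λ i → (i == j) Vector.∷ mk i) marks extend j ρ
  marks-extend h j i zero    = refl
  marks-extend h j i (suc x) = h i x

∀ᴿ : ∀ {A k} {S : Property A (suc k)} → Recogniser A (suc k) S →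
  Recogniser A k (λ n w ρ → allFin (λ j → S n w (extend j ρ)))
∀ᴿ {S = S} R = castᴿ (λ n w ρ → sym (allFin≡not-anyFin-not (λ j → S n w (extend j ρ))))
                     (complementᴿ (∃ᴿ (complementᴿ R)))

∀ᴿ-accepts-[] : ∀ {A k} {S : Property A (suc k)} (R : Recogniser A (suc k) S) →
  accepted (automaton (∀ᴿ R)) [] ≡ true
∀ᴿ-accepts-[] R = cong not (accepted-project (complement (automaton R)) {r = 0} (λ ()))

-- Atomic formulas

settling : ∀ {L} → (L → Fin 3) → Automaton L
settling {L} f = record { states = 3 ; start = 0F ; δ = step ; accept = verdict }
  where
  step : Fin 3 → L → Fin 3
  step 0F      ℓ = f ℓ
  step (suc q) _ = suc q
  verdict : Fin 3 → Bool
  verdict 0F      = false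
  verdict (suc q) = isSet q

run-settled : ∀ {L} (f : L → Fin 3) q u → run (settling f) (suc q) u ≡ suc q
run-settled f q = run-sink (settling f) (suc q) (λ _ → refl)

module _ {A : Set} where

  letterAt : (A → Bool) → Automaton (Marked A 1)
  letterAt π = settling (λ (a , bs) → if bs 0F then suc (bit (π a)) else 0F)

  run-letterAt : ∀ π {n} (w : Fin (suc n) → A) mk p → (∀ i → mk i 0F ≡ (i == p)) →
    run (letterAt π) 0F (annotate w mk) ≡ suc (bit (π (w p)))
  run-letterAt π w mk 0F h rewrite h 0F = run-settled _ _ (tabulate (λ i → w (suc i) , mk (suc i)))
  run-letterAt π {suc n} w mk (suc p) h rewrite h 0F = run-letterAt π (w ∘ suc) (mk ∘ suc) p (h ∘ suc)

  letterᴿ : (π : A → Bool) → Recogniser A 1 (λ n w ρ → π (w (ρ 0F)))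
  letterᴿ π = record
    { automaton = letterAt π
    ; decides   = λ w mk ρ h →
        trans (cong (accept (letterAt π)) (run-letterAt π w mk (ρ 0F) (λ i → h i 0F))) (isSet-bit _)
    }

  isFirst : Automaton (Marked A 1)
  isFirst = settling (λ (_ , bs) → suc (bit (bs 0F)))

  run-isFirst : ∀ {n} (w : Fin (suc n) → A) mk → run isFirst 0F (annotate w mk) ≡ suc (bit (mk 0F 0F))
  run-isFirst {zero}  w mk = refl
  run-isFirst {suc n} w mk = run-settled _ _ (tabulate (λ i → w (suc i) , mk (suc i)))

  firstᴿ : Recogniser A 1 (λ n w ρ → 0F == ρ 0F)
  firstᴿ = record
    { automaton = isFirst
    ; decides   = λ w mk ρ h →
        trans (cong (accept isFirst) (run-isFirst w mk)) (trans (isSet-bit _) (h 0F 0F))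
    }

  isLast : Automaton (Marked A 1)
  isLast = record { states = 2 ; start = 0F ; δ = λ _ ℓ → bit (proj₂ ℓ 0F) ; accept = isSet }

  run-isLast : ∀ {n} (w : Fin (suc n) → A) mk q → run isLast q (annotate w mk) ≡ bit (mk (fromℕ n) 0F)
  run-isLast {zero}  w mk q = refl
  run-isLast {suc n} w mk q = run-isLast (w ∘ suc) (mk ∘ suc) (bit (mk 0F 0F))

  lastᴿ : Recogniser A 1 (λ n w ρ → fromℕ n == ρ 0F)
  lastᴿ = record
    { automaton = isLast
    ; decides   = λ {n} w mk ρ h →
        trans (cong isSet (run-isLast w mk 0F)) (trans (isSet-bit _) (h (fromℕ n) 0F))
    }

  isEqual : Automaton (Marked A 2)
  isEqual = settling (λ (_ , bs) → if bs 0F then suc (bit (bs 1F)) else (if bs 1F then 1F else 0F))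

  run-isEqual : ∀ {n} (w : Fin (suc n) → A) mk p q →
    (∀ i → mk i 0F ≡ (i == p)) → (∀ i → mk i 1F ≡ (i == q)) →
    run isEqual 0F (annotate w mk) ≡ suc (bit (p == q))
  run-isEqual w mk 0F 0F hp hq rewrite hp 0F | hq 0F =
    run-settled _ _ (tabulate (λ i → w (suc i) , mk (suc i)))
  run-isEqual {suc n} w mk 0F (suc q) hp hq rewrite hp 0F | hq 0F =
    run-settled _ _ (tabulate (λ i → w (suc i) , mk (suc i)))
  run-isEqual {suc n} w mk (suc p) 0F hp hq rewrite hp 0F | hq 0F =
    run-settled _ _ (tabulate (λ i → w (suc i) , mk (suc i)))
  run-isEqual {suc n} w mk (suc p) (suc q) hp hq rewrite hp 0F | hq 0F =
    run-isEqual (w ∘ suc) (mk ∘ suc) p q (hp ∘ suc) (hq ∘ suc)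

  equalᴿ : Recogniser A 2 (λ n w ρ → ρ 0F == ρ 1F)
  equalᴿ = record
    { automaton = isEqual
    ; decides   = λ w mk ρ h →
        trans (cong (accept isEqual) (run-isEqual w mk (ρ 0F) (ρ 1F) (λ i → h i 0F) (λ i → h i 1F)))
              (isSet-bit _)
    }

  -- 1F: variable 0 has been seen but variable 1 not yet.
  isLess : Automaton (Marked A 2)
  isLess = record { states = 4 ; start = 0F ; δ = step ; accept = verdict }
    where
    step : Fin 4 → Marked A 2 → Fin 4
    step 0F            (a , bs) = if bs 1F then 2F else (if bs 0F then 1F else 0F)
    step 1F            (a , bs) = if bs 1F then 3F else 1F
    step (suc (suc q)) _        = suc (suc q)
    verdict : Fin 4 → Bool
    verdict (suc (suc q)) = isSet q
    verdict _             = false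

  run-isLess-after : ∀ {n} (w : Fin (suc n) → A) mk q → (∀ i → mk i 1F ≡ (i == q)) →
    run isLess 1F (annotate w mk) ≡ 3F
  run-isLess-after w mk 0F hq rewrite hq 0F =
    run-sink isLess _ (λ _ → refl) (tabulate (λ i → w (suc i) , mk (suc i)))
  run-isLess-after {suc n} w mk (suc q) hq rewrite hq 0F =
    run-isLess-after (w ∘ suc) (mk ∘ suc) q (hq ∘ suc)

  run-isLess : ∀ {n} (w : Fin (suc n) → A) mk p q →
    (∀ i → mk i 0F ≡ (i == p)) → (∀ i → mk i 1F ≡ (i == q)) →
    run isLess 0F (annotate w mk) ≡ suc (suc (bit (does (p <? q))))
  run-isLess w mk 0F 0F hp hq rewrite hq 0F =
    run-sink isLess _ (λ _ → refl) (tabulate (λ i → w (suc i) , mk (suc i)))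
  run-isLess {suc n} w mk 0F (suc q) hp hq rewrite hp 0F | hq 0F =
    run-isLess-after (w ∘ suc) (mk ∘ suc) q (hq ∘ suc)
  run-isLess {suc n} w mk (suc p) 0F hp hq rewrite hq 0F =
    run-sink isLess _ (λ _ → refl) (tabulate (λ i → w (suc i) , mk (suc i)))
  run-isLess {suc n} w mk (suc p) (suc q) hp hq rewrite hp 0F | hq 0F | <?-suc p q =
    run-isLess (w ∘ suc) (mk ∘ suc) p q (hp ∘ suc) (hq ∘ suc)

  lessᴿ : Recogniser A 2 (λ n w ρ → does (ρ 0F <? ρ 1F))
  lessᴿ = record
    { automaton = isLess
    ; decides   = λ w mk ρ h →
        trans (cong (accept isLess) (run-isLess w mk (ρ 0F) (ρ 1F) (λ i → h i 0F) (λ i → h i 1F)))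
              (isSet-bit _)
    }

termᴿ : ∀ {A k} (t : Term k) → Recogniser A (suc k) (λ n w ρ → evalT (ρ ∘ suc) t == ρ 0F)
termᴿ (var x) = relabelᴿ id (λ { 0F → suc x ; 1F → 0F }) equalᴿ
termᴿ min     = relabelᴿ id (λ _ → 0F) firstᴿ
termᴿ max     = relabelᴿ id (λ _ → 0F) lastᴿ

-- R (s , t) holds iff ∃ j₁ j₂. s = j₂ ∧ t = j₁ ∧ R j₂ j₁, the inner quantifier binding variable 0.
relationᴿ : ∀ {A k} {R : ∀ {n} → Fin (suc n) → Fin (suc n) → Bool} →
  Recogniser A 2 (λ n w ρ → R (ρ 0F) (ρ 1F)) → (s t : Term k) →
  Recogniser A k (λ n w ρ → R (evalT ρ s) (evalT ρ t))
relationᴿ {k = k} {R} base s t =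
  castᴿ (λ n w ρ → trans (anyFin-cong (λ j → anyFin-select (evalT ρ s) (λ i → (evalT ρ t == j) ∧ R i j)))
                         (anyFin-select (evalT ρ t) (R (evalT ρ s))))
        (∃ᴿ (∃ᴿ (productᴿ _∧_ (relabelᴿ id first (termᴿ s))
                              (productᴿ _∧_ (relabelᴿ id second (termᴿ t))
                                            (relabelᴿ id (λ { 0F → 0F ; 1F → 1F }) base)))))
  where
  first second : Fin (suc k) → Fin (suc (suc k))
  first  0F      = 0F
  first  (suc x) = suc (suc x)
  second 0F      = 1F
  second (suc x) = suc (suc x)

formulaᴿ : ∀ {m k} (ψ : Formula m k) → Recogniser (Fin m) k (λ n w ρ → eval ψ w ρ)
formulaᴿ (P a t) =
  castᴿ (λ n w ρ → trans (anyFin-select (evalT ρ t) (λ j → w j == a))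
                         (sym (isYes≗does (w (evalT ρ t) ≟ a))))
        (∃ᴿ (productᴿ _∧_ (termᴿ t) (relabelᴿ id (λ _ → 0F) (letterᴿ (_== a)))))
formulaᴿ (s ≺ t)  = castᴿ (λ n w ρ → sym (isYes≗does (evalT ρ s <? evalT ρ t)))
                          (relationᴿ {R = λ i j → does (i <? j)} lessᴿ s t)
formulaᴿ (s ≐ t)  = castᴿ (λ n w ρ → sym (isYes≗does (evalT ρ s ≟ evalT ρ t)))
                          (relationᴿ {R = _==_} equalᴿ s t)
formulaᴿ ⊤f       = constantᴿ true
formulaᴿ (¬f ψ)   = complementᴿ (formulaᴿ ψ)
formulaᴿ (ψ ∧f χ) = productᴿ _∧_ (formulaᴿ ψ) (formulaᴿ χ)
formulaᴿ (ψ ∨f χ) = productᴿ _∨_ (formulaᴿ ψ) (formulaᴿ χ)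
formulaᴿ (∃f ψ)   = ∃ᴿ (formulaᴿ ψ)
formulaᴿ (∀f ψ)   = ∀ᴿ (formulaᴿ ψ)

evalT-cong : ∀ {k n} {ρ ρ′ : Fin k → Fin (suc n)} (t : Term k) → ρ ≗ ρ′ → evalT ρ t ≡ evalT ρ′ t
evalT-cong (var x) e = e x
evalT-cong min     e = refl
evalT-cong max     e = refl

extend-cong : ∀ {k n} (i : Fin n) {ρ ρ′ : Fin k → Fin n} → ρ ≗ ρ′ → extend i ρ ≗ extend i ρ′
extend-cong i e zero    = refl
extend-cong i e (suc x) = e x

eval-cong : ∀ {m k n} (ψ : Formula m k) {w w′ : Fin (suc n) → Fin m} {ρ ρ′ : Fin k → Fin (suc n)} →
  w ≗ w′ → ρ ≗ ρ′ → eval ψ w ρ ≡ eval ψ w′ ρ′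
eval-cong (P a t) {w} ew eρ = cong (λ b → ⌊ b ≟ a ⌋) (trans (cong w (evalT-cong t eρ)) (ew _))
eval-cong (s ≺ t)    ew eρ = cong₂ (λ i j → ⌊ i <? j ⌋) (evalT-cong s eρ) (evalT-cong t eρ)
eval-cong (s ≐ t)    ew eρ = cong₂ (λ i j → ⌊ i ≟ j ⌋) (evalT-cong s eρ) (evalT-cong t eρ)
eval-cong ⊤f         ew eρ = refl
eval-cong (¬f ψ)     ew eρ = cong not (eval-cong ψ ew eρ)
eval-cong (ψ ∧f χ)   ew eρ = cong₂ _∧_ (eval-cong ψ ew eρ) (eval-cong χ ew eρ)
eval-cong (ψ ∨f χ)   ew eρ = cong₂ _∨_ (eval-cong ψ ew eρ) (eval-cong χ ew eρ)
eval-cong (∃f ψ)     ew eρ = anyFin-cong (λ i → eval-cong ψ ew (extend-cong i eρ))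
eval-cong (∀f ψ)     ew eρ = allFin-cong (λ i → eval-cong ψ ew (extend-cong i eρ))

firstTrue-cong : ∀ {s} {f g : Fin s → Bool} → f ≗ g → firstTrue f ≡ firstTrue g
firstTrue-cong {zero}  e = refl
firstTrue-cong {suc s} e = cong₂ (λ b i → if b then zero else suc i) (e zero) (firstTrue-cong (e ∘ suc))

zero==if : ∀ {s} b (i : Fin s) → (zero == (if b then zero else suc i)) ≡ b
zero==if true  i = refl
zero==if false i = refl

suc==if : ∀ {s} b (c i : Fin s) → (suc c == (if b then zero else suc i)) ≡ not b ∧ (c == i)
suc==if true  c i = refl
suc==if false c i = refl

firstTrueᴿ : ∀ {A k s} {S : Fin s → Property A k} → (∀ j → Recogniser A k (S j)) →
  ∀ c → Recogniser A k (λ n w ρ → c == firstTrue (λ j → S j n w ρ))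
firstTrueᴿ {s = zero}          R c       = constantᴿ (c == zero)
firstTrueᴿ {s = suc s} {S}     R zero    =
  castᴿ (λ n w ρ → sym (zero==if (S zero n w ρ) _)) (R zero)
firstTrueᴿ {s = suc s} {S}     R (suc c) =
  castᴿ (λ n w ρ → sym (suc==if (S zero n w ρ) c _))
        (productᴿ _∧_ (complementᴿ (R zero)) (firstTrueᴿ (R ∘ suc) c))

anyᴿ : ∀ {A k t} {S : Fin t → Property A k} → (∀ j → Recogniser A k (S j)) →
  Recogniser A k (λ n w ρ → anyFin (λ j → S j n w ρ))
anyᴿ {t = zero}  R = constantᴿ false
anyᴿ {t = suc t} R = productᴿ _∨_ (R zero) (anyᴿ (R ∘ suc))

-- The quantifier word

map≡tabulate-lookup : ∀ {X Y : Set} (f : X → Y) (u : List X) → map f u ≡ tabulate (f ∘ lookup u)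
map≡tabulate-lookup f u = trans (cong (map f) (sym (tabulate-lookup u))) (map-tabulate (lookup u) f)

lookup-map : ∀ {X Y : Set} (f : X → Y) (u : List X) i →
  lookup (map f u) i ≡ f (lookup u (cast (length-map f u) i))
lookup-map f (x ∷ u) zero    = refl
lookup-map f (x ∷ u) (suc i) = lookup-map f u i

tabulate-injective : ∀ {X : Set} {n} {f g : Fin n → X} → tabulate f ≡ tabulate g → f ≗ g
tabulate-injective {n = suc n} e zero    = ∷-injectiveˡ e
tabulate-injective {n = suc n} e (suc i) = tabulate-injective (∷-injectiveʳ e) i

allFin-==⇔tabulate-≡ : ∀ {n k} (f g : Fin n → Fin k) →
  allFin (λ i → f i == g i) ≡ true ⇔ tabulate f ≡ tabulate g
allFin-==⇔tabulate-≡ f g = mk⇔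
  (λ e → tabulate-cong (λ i → ==⇒≡ (allFin-true⁻ (λ i → f i == g i) e i)))
  (λ e → allFin-true⁺ (λ i → f i == g i)
           (λ i → trans (cong (_== g i) (tabulate-injective e i)) (==-refl (g i))))

toDFA : ∀ {p} → Automaton (Fin p) → DFA p
toDFA M = record { states = states M ; start = start M ; δ = δ M ; accept = accept M }

module QuantifierWord {m s : ℕ} (φ : Fin s → Formula m 1) where

  p : ℕ
  p = m * suc s

  letter : Fin p → Fin m
  letter = quotient (suc s)

  label : Fin p → Fin (suc s)
  label = remainder {m} (suc s)

  qletter : ∀ {n} → (Fin (suc n) → Fin m) → Fin (suc n) → Fin (suc s)
  qletter v i = firstTrue (λ j → eval (φ j) v (λ _ → i))

  qletter-cong : ∀ {n} {v v′ : Fin (suc n) → Fin m} → v ≗ v′ → qletter v ≗ qletter v′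
  qletter-cong e i = firstTrue-cong (λ j → eval-cong (φ j) e (λ _ → refl))

  qword-map : ∀ {X : Set} (f : X → Fin m) x u →
    qword φ (map f (x ∷ u)) ≡ tabulate (qletter (f ∘ lookup (x ∷ u)))
  qword-map f x u = tabulate-cast (length-map f u) (lookup-map f (x ∷ u))
    where
    -- length (map f u) is not definitionally length u.
    tabulate-cast : ∀ {n n′} (e : n ≡ n′) {v : Fin (suc n) → Fin m} {v′ : Fin (suc n′) → Fin m} →
      (∀ i → v i ≡ v′ (cast (cong suc e) i)) → tabulate (qletter v) ≡ tabulate (qletter v′)
    tabulate-cast refl {v′ = v′} h =
      tabulate-cong (qletter-cong (λ i → trans (h i) (cong v′ (cast-is-id _ i))))

  withLabels : ∀ {n} → (Fin (suc n) → Fin m) → Fin (suc n) → Fin p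
  withLabels v i = combine (v i) (qletter v i)

  pairUp : List (Fin m) → List (Fin p)
  pairUp []        = []
  pairUp w@(_ ∷ _) = tabulate (withLabels (lookup w))

  map-letter-pairUp : ∀ w → map letter (pairUp w) ≡ w
  map-letter-pairUp []        = refl
  map-letter-pairUp w@(_ ∷ _) =
    trans (map-tabulate (withLabels (lookup w)) letter)
          (trans (tabulate-cong (λ i → quotient-combine (lookup w i) (qletter (lookup w) i)))
                 (tabulate-lookup w))

  map-label-pairUp : ∀ w → map label (pairUp w) ≡ qword φ w
  map-label-pairUp []        = refl
  map-label-pairUp w@(_ ∷ _) =
    trans (map-tabulate (withLabels (lookup w)) label)
          (tabulate-cong (λ i → remainder-combine (lookup w i) (qletter (lookup w) i)))

  correctAt : ∀ {n} → (Fin (suc n) → Fin p) → Fin (suc n) → Bool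
  correctAt v i = label (v i) == qletter (letter ∘ v) i

  correctLabelᴿ : Recogniser (Fin p) 1 (λ n w ρ → correctAt w (ρ 0F))
  correctLabelᴿ =
    castᴿ (λ n w ρ → anyFin-select (label (w (ρ 0F))) (_== qletter (letter ∘ w) (ρ 0F)))
          (anyᴿ (λ c → productᴿ _∧_ (letterᴿ (λ b → label b == c)) (firstTrueᴿ φᴿ c)))
    where
    φᴿ : ∀ j → Recogniser (Fin p) 1 (λ n w ρ → eval (φ j) (letter ∘ w) (λ _ → ρ 0F))
    φᴿ j = castᴿ (λ n w ρ → eval-cong (φ j) (λ _ → refl) (λ { 0F → refl }))
                 (relabelᴿ letter id (formulaᴿ (φ j)))

  noMarks : Fin 0 → Bool
  noMarks ()

  Consistent : Automaton (Fin p)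
  Consistent = relabel (_, noMarks) (automaton (∀ᴿ correctLabelᴿ))

  accepted-Consistent : ∀ x u → accepted Consistent (x ∷ u) ≡ allFin (correctAt (lookup (x ∷ u)))
  accepted-Consistent x u = begin
    accepted Consistent (x ∷ u)
      ≡⟨ accepted-relabel (_, noMarks) M (x ∷ u) ⟩
    accepted M (map (_, noMarks) (x ∷ u))
      ≡⟨ cong (accepted M) (map≡tabulate-lookup (_, noMarks) (x ∷ u)) ⟩
    accepted M (annotate (lookup (x ∷ u)) (λ _ → noMarks))
      ≡⟨ decides (∀ᴿ correctLabelᴿ) (lookup (x ∷ u)) (λ _ → noMarks) (λ ()) (λ _ ()) ⟩
    allFin (correctAt (lookup (x ∷ u))) ∎
    where
    open ≡-Reasoning
    M : Automaton (Marked (Fin p) 0)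
    M = automaton (∀ᴿ correctLabelᴿ)

  Consistent⇔ : ∀ u → accepted Consistent u ≡ true ⇔ map label u ≡ qword φ (map letter u)
  Consistent⇔ []      = mk⇔ (λ _ → refl) (λ _ → ∀ᴿ-accepts-[] correctLabelᴿ)
  Consistent⇔ (x ∷ u) = mk⇔
    (λ e → trans (map≡tabulate-lookup label v)
                 (trans (to (trans (sym (accepted-Consistent x u)) e)) (sym (qword-map letter x u))))
    (λ e → trans (accepted-Consistent x u)
                 (from (trans (sym (map≡tabulate-lookup label v)) (trans e (qword-map letter x u)))))
    where
    v : List (Fin p)
    v = x ∷ u
    open Equivalence (allFin-==⇔tabulate-≡ (label ∘ lookup v) (qletter (letter ∘ lookup v)))

theorem4 : (m s : ℕ) (B : Language (Fin (suc s))) (φ : Fin s → Formula m 1)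
           (A : Language (Fin m)) → (∀ w → A w ⇔ QSat B φ w) →
           Σ ℕ λ p → Σ (Fin p → Fin (suc s)) λ g → Σ (Fin p → Fin m) λ h →
           Σ (Language (Fin p)) λ D → Regular D ×
           (∀ w → A w ⇔ (∃ λ u → D u × B (hom g u) × hom h u ≡ w))
theorem4 m s B φ A hyp =
  p , label , letter , D , (toDFA Consistent , λ u → id , id) , λ w → mk⇔ (to w) (from w)
  where
  open QuantifierWord φ
  D : Language (Fin p)
  D u = accepted Consistent u ≡ true
  to : ∀ w → A w → ∃ λ u → D u × B (hom label u) × hom letter u ≡ w
  to w Aw = pairUp w
          , Equivalence.from (Consistent⇔ (pairUp w))
              (trans (map-label-pairUp w) (cong (qword φ) (sym (map-letter-pairUp w))))
          , subst B (sym (map-label-pairUp w)) (Equivalence.to (hyp w) Aw)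
          , map-letter-pairUp w
  from : ∀ w → (∃ λ u → D u × B (hom label u) × hom letter u ≡ w) → A w
  from _ (u , u∈D , Bu , refl) =
    Equivalence.from (hyp _) (subst B (Equivalence.to (Consistent⇔ u) u∈D) Bu)
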